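{- Let $K\in\mathcal{K}_0$ and let $x,x'\in K$. Suppose $x/E_1=z_1=x'/E_1$ and $x/E_2=z_2=x'/E_2$ for some $E_1,E_2\in\Lambda$ and $z_1,z_2\in K$. Then there exists $y\in K$ such that $x/(E_1\wedge E_2)=y=x'/(E_1\wedge E_2)$.
   Context: $\Lambda$ is a finite distributive lattice. $\mathcal{L}_0$ is the relational language with a unary predicate $P_{E,1}$ for each $E\in\Lambda$ and a binary relation $U_{E,E'}$ for each pair $E<E'$ in $\Lambda$. An $\mathcal{L}_0$-structure $A$ is $\mathcal{U}_U$-closed if for every $E<E'$ in $\Lambda$ and every $x\in A$: if $P_{E,1}(x)$ holds then there is exactly one $y$ with $U_{E,E'}(x,y)$, and otherwise there is no such $y$. $\mathcal{K}_0$ is the class of all finite $\mathcal{U}_U$-closed $\mathcal{L}_0$-structures such that: (1) the sets $P_{E,1}$, $E\in\Lambda$, partition the domain; (2) if $U_{E,E'}(x,y)$ then $P_{E,1}(x)$ and $P_{E',1}(y)$; (3) (coherence) if $E<E'<E''$, $U_{E,E'}(x,y)$ and $U_{E',E''}(y,z)$, then $U_{E,E''}(x,z)$; (4) (downward semi-closure) if $P_{E,1}(x)$ and $P_{E',1}(x')$ then there is at most one $y$ with $P_{E\wedge E',1}(y)$, $U_{E\wedge E',E}(y,x)$ and $U_{E\wedge E',E'}(y,x')$. Notation: for $x$ with $P_{E,1}(x)$ and $E'\ge E$, $x/E'$ denotes the unique $y$ with $U_{E,E'}(x,y)$ if $E'>E$, and $x/E=x$; likewise $U_{E,E}(y,x)$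 is read as $y=x$. Writing $x/E_i$ presupposes $E_i\ge$ the type $E$ of $x$ (i.e. $P_{E,1}(x)$). -}

module Defs where

open import Level using (Level; _⊔_) renaming (suc to lsuc)
open import Data.Nat using (ℕ)
open import Data.Fin using (Fin)
open import Data.Product using (Σ; Σ-syntax; ∃; ∃-syntax; _×_; _,_)
open import Data.Sum using (_⊎_)
open import Relation.Nullary using (¬_)
open import Relation.Binary.PropositionalEquality using (_≡_)
open import Relation.Binary.Lattice.Bundles using (DistributiveLattice)
open import Function.Bundles using (_↔_)

IsFinite : ∀ {a} → Set a → Set a
IsFinite A = Σ[ n ∈ ℕ ] (A ↔ Fin n)

∃!′ : ∀ {a b} {A : Set a} → (A → Set b) → Set (a ⊔ b)
∃!′ {A = A} R = Σ[ y ∈ A ] (R y × (∀ y' → R y' → y' ≡ y))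

module L0 {c ℓ₁ ℓ₂ : Level} (Λ : DistributiveLattice c ℓ₁ ℓ₂) where
  open DistributiveLattice Λ using (Carrier; _≈_; _≤_; _∧_)

  _<_ : Carrier → Carrier → Set (ℓ₁ ⊔ ℓ₂)
  E < E' = E ≤ E' × ¬ (E ≈ E')

  -- U is given for every pair (E,E'), but only the pairs with
  -- E < E' are symbols of the language; all conditions below only use those.
  record L0Structure (a : Level) : Set (c ⊔ lsuc a) where
    field
      Dom : Set a
      P   : Carrier → Dom → Set a          -- P E x  means  P_{E,1}(x)
      U   : Carrier → Carrier → Dom → Dom → Set a

  module _ {a : Level} (K : L0Structure a) where
    open L0Structure K

    -- U_{E,E'}(x,y) with the convention that U_{E,E}(x,y) is read as x = y
    Ū : Carrier → Carrier → Dom → Dom → Set (a ⊔ ℓ₁ ⊔ ℓ₂)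
    Ū E E' x y = (E ≈ E' × y ≡ x) ⊎ (E < E' × U E E' x y)

    -- x / E' = y : x has some type E (P_{E,1}(x)), E ≤ E', and y is x/E'
    -- (y = x if E = E', and the unique y with U_{E,E'}(x,y) if E < E').
    _/_≐_ : Dom → Carrier → Dom → Set (c ⊔ a ⊔ ℓ₁ ⊔ ℓ₂)
    x / E' ≐ y = Σ[ E ∈ Carrier ] (P E x × Ū E E' x y)

    IsUUClosed : Set (c ⊔ a ⊔ ℓ₁ ⊔ ℓ₂)
    IsUUClosed = ∀ E E' → E < E' → ∀ x →
      (P E x → ∃!′ (λ y → U E E' x y)) × (¬ P E x → ∀ y → ¬ U E E' x y)

    Partition : Set (c ⊔ a ⊔ ℓ₁)
    Partition = (∀ x → ∃[ E ] P E x) × (∀ E E' x → P E x → P E' x → E ≈ E')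

    Typed : Set (c ⊔ a ⊔ ℓ₁ ⊔ ℓ₂)
    Typed = ∀ E E' x y → E < E' → U E E' x y → P E x × P E' y

    Coherent : Set (c ⊔ a ⊔ ℓ₁ ⊔ ℓ₂)
    Coherent = ∀ E E' E'' x y z → E < E' → E' < E'' →
      U E E' x y → U E' E'' y z → U E E'' x z

    DownSemiClosed : Set (c ⊔ a ⊔ ℓ₁ ⊔ ℓ₂)
    DownSemiClosed = ∀ E E' x x' → P E x → P E' x' → ∀ y y' →
      P (E ∧ E') y → Ū (E ∧ E') E y x → Ū (E ∧ E') E' y x' →
      P (E ∧ E') y' → Ū (E ∧ E') E y' x → Ū (E ∧ E') E' y' x' →
      y ≡ y'

  record InK0 {a : Level} (K : L0Structure a) : Set (c ⊔ a ⊔ ℓ₁ ⊔ ℓ₂) where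
    field
      finite         : IsFinite (L0Structure.Dom K)
      uuClosed       : IsUUClosed K
      partition      : Partition K
      typed          : Typed K
      coherent       : Coherent K
      downSemiClosed : DownSemiClosed K

-- Let x have type E.  Since E ≤ E₁ and E ≤ E₂ we have E ≤ M := E₁ ∧ E₂, so y := x/M exists, and
-- by coherence and uniqueness of U-successors y/E₁ = z₁ and y/E₂ = z₂.  The same holds for
-- y' := x'/M, so y and y' are both M-typed common predecessors of z₁ and z₂, and downward
-- semi-closure forces y = y'.
module Submission where

open import Defs
open import Level using (_⊔_)
open import Data.Product using (Σ-syntax; _×_; _,_; proj₁; proj₂)
open import Data.Sum using (inj₁; inj₂)
open import Data.Empty using (⊥-elim)
open import Data.Fin.Properties using (inj⇒≟)
open import Function.Properties.Inverse using (↔⇒↣)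
open import Relation.Nullary using (¬_; yes; no)
open import Relation.Binary.Definitions using (DecidableEquality)
open import Relation.Binary.PropositionalEquality using (_≡_; refl; sym; trans; subst)
open import Relation.Binary.Lattice.Bundles using (DistributiveLattice)

module K0-Properties {c ℓ₁ ℓ₂ a} (Λ : DistributiveLattice c ℓ₁ ℓ₂)
  (finite-Λ : IsFinite (DistributiveLattice.Carrier Λ))
  (≈⇒≡ : ∀ {E E'} → DistributiveLattice._≈_ Λ E E' → E ≡ E')
  (K : L0.L0Structure Λ a) (K∈K0 : L0.InK0 Λ K) where
  open DistributiveLattice Λ using (Carrier; _≤_; _∧_; module Eq; reflexive; antisym; ∧-greatest; x∧y≤x; x∧y≤y)
  open L0 Λ hiding (_/_≐_)
  open L0Structure K
  open InK0 K∈K0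

  _/_≐_ : Dom → Carrier → Dom → Set (c ⊔ a ⊔ ℓ₁ ⊔ ℓ₂)
  _/_≐_ = L0._/_≐_ Λ K

  -- Finiteness of Λ is needed only to decide whether x / F is x itself or its U-successor.
  _≟_ : DecidableEquality Carrier
  _≟_ = inj⇒≟ (↔⇒↣ (proj₂ finite-Λ))

  ≢⇒< : ∀ {E F} → E ≤ F → ¬ E ≡ F → E < F
  ≢⇒< E≤F E≢F = E≤F , λ E≈F → E≢F (≈⇒≡ E≈F)

  Ū⇒≤ : ∀ {E F x y} → Ū K E F x y → E ≤ F
  Ū⇒≤ (inj₁ (E≈F , _))        = reflexive E≈F
  Ū⇒≤ (inj₂ ((E≤F , _) , _)) = E≤F

  Ū-type : ∀ {E F x y} → P E x → Ū K E F x y → P F y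
  Ū-type Px (inj₁ (E≈F , refl)) with ≈⇒≡ E≈F
  ... | refl = Px
  Ū-type Px (inj₂ (E<F , u)) = proj₂ (typed _ _ _ _ E<F u)

  U-unique : ∀ {E F x y z} → E < F → P E x → U E F x y → U E F x z → y ≡ z
  U-unique {E} {F} {x} E<F Px u v with proj₁ (uuClosed E F E<F x) Px
  ... | _ , _ , unique = trans (unique _ u) (sym (unique _ v))

  Ū-exists : ∀ {E F x} → P E x → E ≤ F → Σ[ y ∈ Dom ] Ū K E F x y
  Ū-exists {E} {F} {x} Px E≤F with E ≟ F
  ... | yes refl = x , inj₁ (Eq.refl , refl)
  ... | no E≢F with proj₁ (uuClosed E F (≢⇒< E≤F E≢F) x) Px
  ...   | y , u , _ = y , inj₂ (≢⇒< E≤F E≢F , u)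

  -- Partition pins down the type of x, so a witness of x / F ≐ z can be read at any type of x.
  ≐⇒Ū : ∀ {E F x z} → P E x → x / F ≐ z → Ū K E F x z
  ≐⇒Ū {x = x} Px (G , Gx , u) with ≈⇒≡ (proj₂ partition G _ x Gx Px)
  ... | refl = u

  Ū-factor : ∀ {E M F x y z} → P E x → Ū K E M x y → Ū K E F x z → M ≤ F → Ū K M F y z
  Ū-factor Px (inj₁ (E≈M , refl)) v M≤F with ≈⇒≡ E≈M
  ... | refl = v
  Ū-factor Px (inj₂ ((E≤M , E≉M) , u)) (inj₁ (E≈F , _)) M≤F with ≈⇒≡ E≈F
  ... | refl = ⊥-elim (E≉M (antisym E≤M M≤F))
  Ū-factor {E} {M} {F} {x} {y} Px (inj₂ (E<M , u)) (inj₂ (E<F , v)) M≤F with M ≟ F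
  ... | yes refl = inj₁ (Eq.refl , U-unique E<M Px v u)
  ... | no M≢F with proj₁ (uuClosed M F (≢⇒< M≤F M≢F) y) (Ū-type Px (inj₂ (E<M , u)))
  ...   | w , u′ , _ = inj₂ (M<F , subst (U M F y) (U-unique E<F Px through-y v) u′)
    where
    M<F = ≢⇒< M≤F M≢F
    through-y : U E F x w
    through-y = coherent E M F x y w E<M M<F u u′

  meet-predecessor : ∀ {E E₁ E₂ x z₁ z₂} → P E x → Ū K E E₁ x z₁ → Ū K E E₂ x z₂ →
    Σ[ y ∈ Dom ] (Ū K E (E₁ ∧ E₂) x y × Ū K (E₁ ∧ E₂) E₁ y z₁ × Ū K (E₁ ∧ E₂) E₂ y z₂)
  meet-predecessor {E₁ = E₁} {E₂} Px u₁ u₂ with Ū-exists Px (∧-greatest (Ū⇒≤ u₁) (Ū⇒≤ u₂))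
  ... | y , u = y , u , Ū-factor Px u u₁ (x∧y≤x E₁ E₂) , Ū-factor Px u u₂ (x∧y≤y E₁ E₂)

  common-meet-quotient : ∀ {x x' E₁ E₂ z₁ z₂} → x / E₁ ≐ z₁ → x' / E₁ ≐ z₁ → x / E₂ ≐ z₂ → x' / E₂ ≐ z₂ →
    Σ[ y ∈ Dom ] (x / (E₁ ∧ E₂) ≐ y × x' / (E₁ ∧ E₂) ≐ y)
  common-meet-quotient {x' = x'} {E₁} {E₂} {z₁} {z₂} x/E₁@(E , Px , _) x'/E₁@(E' , Px' , _) x/E₂ x'/E₂
    with meet-predecessor Px (≐⇒Ū Px x/E₁) (≐⇒Ū Px x/E₂)
       | meet-predecessor Px' (≐⇒Ū Px' x'/E₁) (≐⇒Ū Px' x'/E₂)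
  ... | y , x→y , y→z₁ , y→z₂ | y' , x'→y' , y'→z₁ , y'→z₂ =
    y , (E , Px , x→y) , (E' , Px' , subst (Ū K E' (E₁ ∧ E₂) x') (sym y≡y') x'→y')
    where
    y≡y' : y ≡ y'
    y≡y' = downSemiClosed E₁ E₂ z₁ z₂ (Ū-type Px (≐⇒Ū Px x/E₁)) (Ū-type Px (≐⇒Ū Px x/E₂)) y y'
             (Ū-type Px x→y) y→z₁ y→z₂ (Ū-type Px' x'→y') y'→z₁ y'→z₂

proposition4p3 : ∀ {c ℓ₁ ℓ₂ a} (Λ : DistributiveLattice c ℓ₁ ℓ₂) →
    IsFinite (DistributiveLattice.Carrier Λ) →
    (∀ {E E'} → DistributiveLattice._≈_ Λ E E' → E ≡ E') →
    (K : L0.L0Structure Λ a) → L0.InK0 Λ K →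
    (x x' : L0.L0Structure.Dom K) (E₁ E₂ : DistributiveLattice.Carrier Λ) (z₁ z₂ : L0.L0Structure.Dom K) →
    L0._/_≐_ Λ K x E₁ z₁ → L0._/_≐_ Λ K x' E₁ z₁ →
    L0._/_≐_ Λ K x E₂ z₂ → L0._/_≐_ Λ K x' E₂ z₂ →
    Σ[ y ∈ L0.L0Structure.Dom K ]
    (L0._/_≐_ Λ K x (DistributiveLattice._∧_ Λ E₁ E₂) y × L0._/_≐_ Λ K x' (DistributiveLattice._∧_ Λ E₁ E₂) y)
proposition4p3 Λ finite-Λ ≈⇒≡ K K∈K0 x x' E₁ E₂ z₁ z₂ =
  K0-Properties.common-meet-quotient Λ finite-Λ ≈⇒≡ K K∈K0
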